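{- Let $F$ be a maximum matching in a graph $G$ and $K=E(G)\setminus F$. Let $(Q,R,S)$ be a decomposition of $V(G)$ into disjoint sets such that: (1) $F[Q]$ is a perfect matching of $Q$; (2) $R=\bigcup_{i\in I}V(H_i)$, where each $H_i$ is a hypomatchable connected component of $G-S$, and $F[V(H_i)]$ covers all of $V(H_i)$ except one vertex $r_i$; (3) $S\subseteq\bigcup F$ and for every $s\in S$ the $F$-partner of $s$ is $r_i$ for some $i\in I$; and suppose moreover that $OR(K,F)=S\cup\bigcup_{i\in I}(V(H_i)\setminus\{r_i\})$ (equivalently, $V(G)\setminus OR(K,F)=Q\cup\{r_i: i\in I\}$). Then a pair $e$ of vertices of $G$ with $e\notin E(G)$ is enriching if and only if $e$ joins a vertex of some $V(H_i)$ to either a vertex of $V(H_k)$ for some $k\neq i$, or to a vertex of $Q$.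
   Context: A graph is hypomatchable if deleting any single vertex leaves a graph with a perfect matching. For a set of edges $F$ and a vertex set $X$, $F[X]=\{f\in F: f\subseteq X\}$; $\bigcup F$ is the set of vertices covered by $F$. Paths are simple. A path is $K$-$F$-alternating if its odd-numbered edges belong to $K$ and its even-numbered edges belong to $F$. A vertex $v$ is oddly $K$-reachable from $a$ if there is a $K$-$F$-alternating path starting at $a$ with an edge $ab\in K$, ending at $v$, with an odd number of edges. $OR(K,F)$ is the set of vertices oddly $K$-reachable from some vertex not covered by $F$. A pair $e$ of vertices is enriching if $OR(K\cup\{e\},F)\supsetneq OR(K,F)$. (Such a decomposition satisfying the extra condition exists: take one with $Q$ maximal under containment.) -}

module Defs where

open import Data.Nat using (ℕ; zero; suc; _+_; _≤_)
open import Data.Fin using (Fin; _<?_; _≟_)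
open import Data.Bool using (Bool; true; false; _∧_; _∨_; not; if_then_else_)
open import Data.List using (List; []; _∷_; _++_; [_]; length)
open import Data.List.Relation.Unary.Unique.Propositional using (Unique)
open import Data.Product using (Σ; ∃; _×_; _,_)
open import Data.Sum using (_⊎_)
open import Data.Empty using (⊥)
open import Data.Unit using (⊤)
open import Relation.Nullary using (¬_)
open import Relation.Nullary.Decidable using (⌊_⌋)
open import Relation.Binary.PropositionalEquality using (_≡_; _≢_)

BRel : ℕ → Set
BRel n = Fin n → Fin n → Bool

VSet : ℕ → Set₁
VSet n = Fin n → Set

record Graph (n : ℕ) : Set where
  field
    adj     : BRel n
    adj-sym : ∀ x y → adj x y ≡ adj y x
    adj-irr : ∀ x → adj x x ≡ false
open Graph public

sumFin : ∀ {n} → (Fin n → ℕ) → ℕ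
sumFin {zero}  f = 0
sumFin {suc n} f = f Fin.zero + sumFin (λ i → f (Fin.suc i))

edgeCount : ∀ {n} → BRel n → ℕ
edgeCount E = sumFin (λ x → sumFin (λ y →
  if ⌊ x <? y ⌋ ∧ E x y then 1 else 0))

record IsMatching {n} (G : Graph n) (M : BRel n) : Set where
  field
    sub  : ∀ x y → M x y ≡ true → adj G x y ≡ true
    sym  : ∀ x y → M x y ≡ M y x
    uniq : ∀ x y z → M x y ≡ true → M x z ≡ true → y ≡ z

record IsMaximumMatching {n} (G : Graph n) (F : BRel n) : Set₁ where
  field
    matching : IsMatching G F
    maximum  : ∀ M → IsMatching G M → edgeCount M ≤ edgeCount F

Covered : ∀ {n} → BRel n → Fin n → Set
Covered F x = ∃ λ y → F x y ≡ true

Kof : ∀ {n} → Graph n → BRel n → BRel n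
Kof G F x y = adj G x y ∧ not (F x y)

addPair : ∀ {n} → BRel n → Fin n → Fin n → BRel n
addPair K a b x y =
  K x y ∨ ((⌊ x ≟ a ⌋ ∧ ⌊ y ≟ b ⌋) ∨ (⌊ x ≟ b ⌋ ∧ ⌊ y ≟ a ⌋))

Alt : ∀ {n} → BRel n → BRel n → Bool → List (Fin n) → Set
Alt K F b []            = ⊤
Alt K F b (x ∷ [])      = ⊤
Alt K F b (x ∷ y ∷ vs)  =
  ((if b then K x y else F x y) ≡ true) × Alt K F (not b) (y ∷ vs)

-- The vertex list is a ∷ (ps ++ [ v ]) so the
-- number of edges is length ps + 1; it is odd iff length ps is even.
OddlyReachable : ∀ {n} → BRel n → BRel n → Fin n → Fin n → Set
OddlyReachable K F a v = ∃ λ (ps : List _) →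
  Unique (a ∷ (ps ++ [ v ])) ×
  Alt K F true (a ∷ (ps ++ [ v ])) ×
  (∃ λ m → length ps ≡ m + m)

OR : ∀ {n} → BRel n → BRel n → VSet n
OR K F v = ∃ λ a → ¬ Covered F a × OddlyReachable K F a v

Enriching : ∀ {n} → BRel n → BRel n → Fin n → Fin n → Set
Enriching K F a b =
  (∀ v → OR K F v → OR (addPair K a b) F v) ×
  (∃ λ v → OR (addPair K a b) F v × ¬ OR K F v)

-- Walks in G all of whose vertices (after the first) lie in P.
data ConnIn {n} (G : Graph n) (P : VSet n) : Fin n → Fin n → Set where
  here : ∀ {x} → ConnIn G P x x
  step : ∀ {x y z} → adj G x y ≡ true → P y → ConnIn G P y z → ConnIn G P x z

IsComponentMinus : ∀ {n} → Graph n → VSet n → VSet n → Set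
IsComponentMinus G S H =
  (∃ λ x → H x) ×
  (∀ x → H x → ¬ S x) ×
  (∀ x y → H x → H y → ConnIn G H x y) ×
  (∀ x y → H x → ¬ S y → adj G x y ≡ true → H y)

Hypomatchable : ∀ {n} → Graph n → VSet n → Set
Hypomatchable G H = ∀ v → H v → ∃ λ M →
  IsMatching G M ×
  (∀ x y → M x y ≡ true → H x × H y × x ≢ v × y ≢ v) ×
  (∀ x → H x → x ≢ v → Covered M x)

module Submission where

-- Write Odd = S ∪ ⋃ᵢ (V(Hᵢ) \ {rᵢ}); by hypothesis Odd = OR(K,F).  The proof
-- rests on one invariant of alternating paths.  Call an edge relation E
-- component-respecting if every E-edge leaving a component Hⱼ ends in Hⱼ or
-- in S; K is such a relation.  Along an alternating E-path starting at an
-- F-exposed vertex (an exposed vertex is some root rⱼ), one then stays out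
-- of Q, is inside some Hⱼ after an even number of edges and in Odd after an
-- odd number, and enters each Hⱼ through rⱼ, so that every vertex of Hⱼ
-- reached evenly is reached from rⱼ by an even alternating path inside Hⱼ.
--
-- (⇒) If {x,y} joins neither two distinct components nor a component to Q,
--     then K ∪ {xy} is still component-respecting, so every oddly reachable
--     vertex is in Odd = OR(K,F): nothing new is reached.
-- (⇐) Monotonicity gives OR(K,F) ⊆ OR(K ∪ {xy},F).  If x ∈ Hᵢ and y ∈ Q,
--     an even path to x followed by xy reaches y ∉ Odd.  If x ∈ Hᵢ and
--     y ∈ Hₖ (i ≠ k), an even path to rᵢ, a path inside Hᵢ to x, the edge
--     xy and a reversed path inside Hₖ from y reach rₖ ∉ Odd (or, if the
--     path to rᵢ already meets rₖ, the same with the roles of i, k swapped).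

open import Defs
open import Data.Nat using (ℕ; zero; suc; _+_)
open import Data.Nat.Properties using (+-suc; suc-injective)
open import Data.Fin using (Fin; _≟_)
open import Data.Fin.Properties using (any?)
open import Data.Bool using (Bool; true; false; not; _∧_; _∨_; if_then_else_)
open import Data.Bool.Properties
  using (∧-conicalˡ; ∨-zeroʳ; not-involutive; not-¬; T-≡; T-∧; T-∨)
  renaming (_≟_ to _≟ᵇ_)
open import Data.Unit using (tt)
open import Data.List using (List; []; _∷_; _++_; [_]; length)
open import Data.List.Relation.Unary.Any using (here; there)
open import Data.List.Relation.Unary.All as All using (All; []; _∷_)
open import Data.List.Relation.Unary.AllPairs using ([]; _∷_)
open import Data.List.Membership.Propositional using (_∈_; _∉_)
open import Data.List.Membership.Propositional.Properties using (∈-++⁻)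
import Data.List.Membership.DecPropositional as DecMembership
open import Data.List.Relation.Unary.Unique.Propositional using (Unique)
import Data.List.Relation.Unary.Unique.Propositional.Properties as Unique
open import Data.Product using (Σ; ∃; _×_; _,_; proj₁; proj₂)
open import Data.Sum using (_⊎_; inj₁; inj₂)
open import Data.Empty using (⊥; ⊥-elim)
open import Function using (_∘_; id)
open import Relation.Nullary using (¬_; yes; no)
open import Relation.Nullary.Decidable using (⌊_⌋; toWitness; fromWitness)
open import Relation.Binary.PropositionalEquality
  using (_≡_; _≢_; refl; sym; trans; cong; cong₂; subst)
open import Function.Bundles using (_⇔_; mk⇔; Equivalence)

_⊑_ : ∀ {n} → BRel n → BRel n → Set
E ⊑ E′ = ∀ x y → E x y ≡ true → E′ x y ≡ true

SymmetricRel : ∀ {n} → BRel n → Set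
SymmetricRel E = ∀ x y → E x y ≡ E y x

≟-diag : ∀ {n} (u : Fin n) → ⌊ u ≟ u ⌋ ≡ true
≟-diag u = Equivalence.to T-≡ (fromWitness {a? = u ≟ u} refl)

module _ {n : ℕ} {E : BRel n} {a b : Fin n} where

  addPair-⊒ : E ⊑ addPair E a b
  addPair-⊒ u w e rewrite e = refl

  addPair-ab : addPair E a b a b ≡ true
  addPair-ab rewrite ≟-diag a | ≟-diag b = ∨-zeroʳ (E a b)

  addPair-ba : addPair E a b b a ≡ true
  addPair-ba rewrite ≟-diag a | ≟-diag b =
    trans (cong (E b a ∨_) (∨-zeroʳ _)) (∨-zeroʳ (E b a))

  addPair-cases : ∀ {u w} → addPair E a b u w ≡ true →
    E u w ≡ true ⊎ (u ≡ a × w ≡ b) ⊎ (u ≡ b × w ≡ a)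
  addPair-cases {u} {w} e
    with Equivalence.to (T-∨ {E u w}) (Equivalence.from T-≡ e)
  ... | inj₁ old = inj₁ (Equivalence.to T-≡ old)
  ... | inj₂ new with Equivalence.to (T-∨ {⌊ u ≟ a ⌋ ∧ ⌊ w ≟ b ⌋}) new
  ... | inj₁ ab = let (ua , wb) = Equivalence.to (T-∧ {⌊ u ≟ a ⌋}) ab in
                  inj₂ (inj₁ (toWitness {a? = u ≟ a} ua , toWitness {a? = w ≟ b} wb))
  ... | inj₂ ba = let (ub , wa) = Equivalence.to (T-∧ {⌊ u ≟ b ⌋}) ba in
                  inj₂ (inj₂ (toWitness {a? = u ≟ b} ub , toWitness {a? = w ≟ a} wa))

-- flips k b: the colour of the edge following k alternating edges, the
-- first of which had colour b.
flips : ℕ → Bool → Bool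
flips zero    b = b
flips (suc k) b = flips k (not b)

flips-not : ∀ k b → flips k (not b) ≡ not (flips k b)
flips-not zero    b = refl
flips-not (suc k) b = flips-not k (not b)

flips-∷ʳ : ∀ {A : Set} (xs : List A) x b → flips (length (xs ++ [ x ])) b ≡ not (flips (length xs) b)
flips-∷ʳ []       x b = refl
flips-∷ʳ (_ ∷ xs) x b = flips-∷ʳ xs x (not b)

flips-fixed⇒even : ∀ k b → flips k b ≡ b → ∃ λ m → k ≡ m + m
flips-fixed⇒even zero          b _  = 0 , refl
flips-fixed⇒even (suc zero)    b eq = ⊥-elim (not-¬ refl (sym eq))
flips-fixed⇒even (suc (suc k)) b eq
  with flips-fixed⇒even k b (subst (λ c → flips k c ≡ b) (not-involutive b) eq)
... | m , k≡m+m = suc m , cong suc (trans (cong suc k≡m+m) (sym (+-suc m m)))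

module AlternatingPaths {n : ℕ} (F : BRel n) where

  private variable
    E E′ : BRel n
    a u v w : Fin n
    b c d : Bool
    vs ws : List (Fin n)

  Step : BRel n → Bool → Fin n → Fin n → Set
  Step E c u w = (if c then E u w else F u w) ≡ true

  infix 4 _⊆_
  _⊆_ : List (Fin n) → List (Fin n) → Set
  xs ⊆ ys = ∀ {z} → z ∈ xs → z ∈ ys

  -- Path E b a c u vs: a simple alternating path from a to u whose first
  -- edge has colour b and whose next edge would have colour c; vs lists its
  -- vertices, most recent first.
  data Path (E : BRel n) (b : Bool) (a : Fin n) : Bool → Fin n → List (Fin n) → Set where
    start  : Path E b a b a [ a ]
    extend : ∀ {c u vs w} → Path E b a c u vs → Step E c u w → w ∉ vs →
             Path E b a (not c) w (w ∷ vs)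

  end∈ : Path E b a c u vs → u ∈ vs
  end∈ start          = here refl
  end∈ (extend _ _ _) = here refl

  start∈ : Path E b a c u vs → a ∈ vs
  start∈ start          = here refl
  start∈ (extend p _ _) = there (start∈ p)

  step-mono : E ⊑ E′ → ∀ c → Step E c u w → Step E′ c u w
  step-mono E⊑E′ true  e = E⊑E′ _ _ e
  step-mono E⊑E′ false e = e

  path-mono : E ⊑ E′ → Path E b a c u vs → Path E′ b a c u vs
  path-mono E⊑E′ start                      = start
  path-mono E⊑E′ (extend {c = c} p e w∉) = extend (path-mono E⊑E′ p) (step-mono E⊑E′ c e) w∉

  append : Path E b a c u vs → Path E c u d w ws → (∀ {z} → z ∈ ws → z ∈ vs → z ≡ u) →
           ∃ λ zs → Path E b a d w zs × (∀ {z} → z ∈ zs → z ∈ vs ⊎ z ∈ ws)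
  append p start meet = _ , p , inj₁
  append {vs = vs} p (extend {vs = ws} {w = x} q e x∉) meet
    with append p q (meet ∘ there)
  ... | zs , pq , cover = x ∷ zs , extend pq e x∉zs , cover′
    where
      x∉zs : x ∉ zs
      x∉zs x∈ with cover x∈
      ... | inj₁ x∈vs = x∉ (subst (_∈ ws) (sym (meet (here refl) x∈vs)) (start∈ q))
      ... | inj₂ x∈ws = x∉ x∈ws
      cover′ : ∀ {z} → z ∈ x ∷ zs → z ∈ vs ⊎ z ∈ x ∷ ws
      cover′ (here eq) = inj₂ (here eq)
      cover′ (there z∈) with cover z∈
      ... | inj₁ z∈vs = inj₁ z∈vs
      ... | inj₂ z∈ws = inj₂ (there z∈ws)

  prepend : Step E d w a → w ∉ vs → Path E (not d) a c u vs →
            ∃ λ ws → Path E d w c u ws × ws ⊆ (w ∷ vs)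
  prepend {w = w} {a = a} e w∉ start = a ∷ [ w ] , extend start e a∉ , swap
    where
      a∉ : a ∉ [ w ]
      a∉ (here a≡w) = w∉ (here (sym a≡w))
      swap : a ∷ [ w ] ⊆ w ∷ [ a ]
      swap (here eq)         = there (here eq)
      swap (there (here eq)) = here eq
  prepend {w = w} e w∉ (extend {vs = vs} {w = x} p e′ x∉) with prepend e (w∉ ∘ there) p
  ... | ws , p′ , sub = x ∷ ws , extend p′ e′ x∉ws , sub′
    where
      x∉ws : x ∉ ws
      x∉ws x∈ with sub x∈
      ... | here x≡w = w∉ (here (sym x≡w))
      ... | there h  = x∉ h
      sub′ : x ∷ ws ⊆ (w ∷ x ∷ vs)
      sub′ (here eq) = there (here eq)
      sub′ (there z∈) with sub z∈
      ... | here eq = here eq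
      ... | there h = there (there h)

  step-sym : SymmetricRel E → SymmetricRel F → ∀ c → Step E c u w → Step E c w u
  step-sym E-sym F-sym true  e = trans (E-sym _ _) e
  step-sym E-sym F-sym false e = trans (F-sym _ _) e

  reverse : SymmetricRel E → SymmetricRel F → Path E b a c u vs →
            ∃ λ ws → Path E (not c) u (not b) a ws × ws ⊆ vs
  reverse E-sym F-sym start = _ , start , id
  reverse {E = E} E-sym F-sym (extend {c = c} {w = w} p e w∉) with reverse E-sym F-sym p
  ... | ws , rp , sub with prepend (step-sym E-sym F-sym c e) (w∉ ∘ sub) rp
  ... | ws′ , rp′ , sub′ =
    ws′ , subst (λ d → Path E d w _ _ ws′) (sym (not-involutive c)) rp′ , sub″
    where
      sub″ : ws′ ⊆ (w ∷ _)
      sub″ z∈ with sub′ z∈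
      ... | here eq = here eq
      ... | there h = there (sub h)

  record Prefix (E : BRel n) (b : Bool) (a : Fin n) (c : Bool) (u : Fin n)
                (vs : List (Fin n)) (z : Fin n) : Set where
    field
      colour   : Bool
      vertices : List (Fin n)
      path     : Path E b a colour z vertices
      ⊆-whole  : vertices ⊆ vs
      end∉     : u ∉ vertices
      next     : Fin n
      exit     : Step E colour z next
      next∈    : next ∈ vs
      next-end : next ≡ u → c ≡ not colour

  prefix : Path E b a c u vs → ∀ {z} → z ∈ vs → z ≢ u → Prefix E b a c u vs z
  prefix start          (here z≡u) z≢u = ⊥-elim (z≢u z≡u)
  prefix (extend _ _ _) (here z≡u) z≢u = ⊥-elim (z≢u z≡u)
  prefix (extend {c = c} {u = u} {w = w} p e w∉) {z} (there z∈) _ with z ≟ u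
  ... | yes refl = record
    { colour = c ; vertices = _ ; path = p ; ⊆-whole = there ; end∉ = w∉
    ; next = w ; exit = e ; next∈ = here refl ; next-end = λ _ → refl }
  ... | no z≢u = record
    { colour = colour ; vertices = vertices ; path = path
    ; ⊆-whole  = there ∘ ⊆-whole
    ; end∉     = w∉ ∘ ⊆-whole
    ; next = next ; exit = exit
    ; next∈    = there next∈
    ; next-end = λ next≡w → ⊥-elim (w∉ (subst (_∈ _) next≡w next∈)) }
    where open Prefix (prefix p z∈ z≢u)

  -- Following an odd alternating vertex list from the end of an even path
  -- (walking two edges at a time) gives an odd path.
  extend-odd : Path E b a true u vs → (ps : List (Fin n)) {k : ℕ} →
    Alt E F true (u ∷ ps ++ [ v ]) → Unique (u ∷ ps ++ [ v ]) →
    (∀ {z} → z ∈ ps ++ [ v ] → z ∉ vs) → length ps ≡ k + k →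
    ∃ λ ws → Path E b a false v ws
  extend-odd p [] (e , _) _ fresh _ = _ , extend p e (fresh (here refl))
  extend-odd p (_ ∷ []) {zero}  _ _ _ ()
  extend-odd p (_ ∷ []) {suc k} _ _ _ eq with trans (suc-injective eq) (+-suc k k)
  ... | ()
  extend-odd p (_ ∷ _ ∷ _) {zero} _ _ _ ()
  extend-odd {vs = vs} {v = v} p (p₁ ∷ p₂ ∷ ps) {suc k} (e₁ , e₂ , alt)
             (_ ∷ p₁≢ ∷ uniq@(p₂≢ ∷ _)) fresh eq =
    extend-odd (extend (extend p e₁ (fresh (here refl))) e₂ p₂∉) ps {k} alt uniq fresh′
      (suc-injective (trans (suc-injective eq) (+-suc k k)))
    where
      p₂∉ : p₂ ∉ p₁ ∷ vs
      p₂∉ (here p₂≡p₁) = All.head p₁≢ (sym p₂≡p₁)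
      p₂∉ (there h)    = fresh (there (here refl)) h
      fresh′ : ∀ {z} → z ∈ ps ++ [ v ] → z ∉ p₂ ∷ p₁ ∷ vs
      fresh′ z∈ (here z≡p₂)         = All.lookup p₂≢ z∈ (sym z≡p₂)
      fresh′ z∈ (there (here z≡p₁)) = All.lookup p₁≢ (there z∈) (sym z≡p₁)
      fresh′ z∈ (there (there h))   = fresh (there (there z∈)) h

  fromOR : OddlyReachable E F a v → ∃ λ vs → Path E true a false v vs
  fromOR {a = a} {v = v} (ps , uniq@(a≢ ∷ _) , alt , k , len) = extend-odd start ps {k} alt uniq fresh len
    where
      fresh : ∀ {z} → z ∈ ps ++ [ v ] → z ∉ [ a ]
      fresh z∈ (here z≡a) = All.lookup a≢ z∈ (sym z≡a)

  alt-∷ʳ : ∀ b xs u w → Alt E F b (xs ++ [ u ]) → Step E (flips (length xs) b) u w →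
           Alt E F b ((xs ++ [ u ]) ++ [ w ])
  alt-∷ʳ b []           u w _         e = e , tt
  alt-∷ʳ b (x ∷ [])     u w (e₀ , _)   e = e₀ , e , tt
  alt-∷ʳ b (x ∷ y ∷ xs) u w (e₀ , alt) e = e₀ , alt-∷ʳ (not b) (y ∷ xs) u w alt e

  forward : Path E b a c u vs → Step E c u w → w ∉ vs →
    ∃ λ ps → Alt E F b (a ∷ ps ++ [ w ]) × Unique (a ∷ ps ++ [ w ]) ×
             (a ∷ ps ++ [ w ]) ⊆ (w ∷ vs) × flips (length ps) b ≡ c
  forward {a = a} {w = w} start e w∉ =
    [] , (e , tt) , ((a≢w ∷ []) ∷ [] ∷ []) , swap , refl
    where
      a≢w : a ≢ w
      a≢w a≡w = w∉ (here (sym a≡w))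
      swap : a ∷ [ w ] ⊆ w ∷ [ a ]
      swap (here eq)         = there (here eq)
      swap (there (here eq)) = here eq
  forward {E = E} {b = b} {a = a} {w = w} (extend {c = c} {vs = vs} {w = u} p e′ u∉) e w∉
    with forward p e′ u∉
  ... | ps , alt , uniq , sub , colour =
    ps ++ [ u ] ,
    alt-∷ʳ b (a ∷ ps) u w alt
      (subst (λ d → Step E d u w) (sym (trans (flips-not (length ps) b) (cong not colour))) e) ,
    Unique.++⁺ uniq ([] ∷ []) (λ { (w∈ , here refl) → w∉ (sub w∈) }) ,
    sub′ ,
    trans (flips-∷ʳ ps u b) (cong not colour)
    where
      sub′ : (a ∷ ps ++ [ u ]) ++ [ w ] ⊆ (w ∷ u ∷ vs)
      sub′ z∈ with ∈-++⁻ (a ∷ ps ++ [ u ]) z∈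
      ... | inj₁ h         = there (sub h)
      ... | inj₂ (here eq) = here eq

  -- An odd path (next colour false) witnesses odd reachability.  The colour
  -- is a variable constrained by an equation so that the case split on the
  -- last step is possible.
  toOR : Path E true a c v vs → c ≡ false → OddlyReachable E F a v
  toOR (extend {c = true} p e w∉) _ with forward p e w∉
  ... | ps , alt , uniq , _ , colour = ps , uniq , alt , flips-fixed⇒even (length ps) true colour

  alt-mono : E ⊑ E′ → ∀ b xs → Alt E F b xs → Alt E′ F b xs
  alt-mono E⊑E′ b []           _         = tt
  alt-mono E⊑E′ b (x ∷ [])     _         = tt
  alt-mono E⊑E′ b (x ∷ y ∷ xs) (e , alt) =
    step-mono E⊑E′ b e , alt-mono E⊑E′ (not b) (y ∷ xs) alt

  OR-mono : E ⊑ E′ → OR E F v → OR E′ F v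
  OR-mono E⊑E′ (a , exposed , ps , uniq , alt , even) =
    a , exposed , ps , uniq , alt-mono E⊑E′ true _ alt , even

module Decomposition
  {n m : ℕ} (G : Graph n) (F : BRel n)
  (Q R S : VSet n) (H : Fin m → VSet n) (r : Fin m → Fin n)
  (F-matching : IsMatching G F)
  (partition : ∀ v → Q v ⊎ R v ⊎ S v)
  (Q∩R : ∀ v → Q v → ¬ R v) (Q∩S : ∀ v → Q v → ¬ S v) (R∩S : ∀ v → R v → ¬ S v)
  (Q-perfect : ∀ q → Q q → ∃ λ y → Q y × F q y ≡ true)
  (R-union : ∀ v → R v ⇔ (∃ λ i → H i v))
  (H-disjoint : ∀ i k v → H i v → H k v → i ≡ k)
  (H-component : ∀ i → IsComponentMinus G S (H i))
  (r∈H : ∀ i → H i (r i))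
  (H-near-perfect : ∀ i v → H i v → v ≢ r i → ∃ λ u → H i u × F v u ≡ true)
  (r-exposed-in-H : ∀ i → ¬ (∃ λ u → H i u × F (r i) u ≡ true))
  (S-to-roots : ∀ s → S s → ∃ λ i → F s (r i) ≡ true)
  (OR-shape : ∀ v → OR (Kof G F) F v ⇔ (S v ⊎ (∃ λ i → H i v × v ≢ r i)))
  where

  open AlternatingPaths F
  open IsMatching F-matching renaming (sub to F⊆G; sym to F-sym; uniq to F-unique)
  open DecMembership (_≟_ {n}) using (_∈?_)

  private variable
    E : BRel n
    a s u v w x x′ y : Fin n
    c : Bool
    vs : List (Fin n)
    i j k : Fin m

  K : BRel n
  K = Kof G F

  Odd : VSet n
  Odd v = S v ⊎ (∃ λ i → H i v × v ≢ r i)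

  F-loopless : F x y ≡ true → x ≢ y
  F-loopless {x} e refl with trans (sym (F⊆G x x e)) (adj-irr G x)
  ... | ()

  K-sym : SymmetricRel K
  K-sym x y = cong₂ (λ p q → p ∧ not q) (adj-sym G x y) (F-sym x y)

  H∌S : H j v → ¬ S v
  H∌S {j} {v} = proj₁ (proj₂ (H-component j)) v

  H∌Q : H j v → ¬ Q v
  H∌Q {j} {v} h q = Q∩R v q (Equivalence.from (R-union v) (j , h))

  H-closed : H j u → ¬ S w → adj G u w ≡ true → H j w
  H-closed {j} = proj₂ (proj₂ (proj₂ (H-component j))) _ _

  S? : ∀ v → S v ⊎ ¬ S v
  S? v with partition v
  ... | inj₁ q          = inj₂ (Q∩S v q)
  ... | inj₂ (inj₁ rv)  = inj₂ (R∩S v rv)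
  ... | inj₂ (inj₂ sv)  = inj₁ sv

  same-component : H j v → H k v → r j ≡ r k
  same-component {j} {v} {k} hj hk = cong r (H-disjoint j k v hj hk)

  -- The F-exposed vertices are roots (Q and S are covered, as is H \ r).
  exposed-is-root : ¬ Covered F a → ∃ λ j → a ≡ r j
  exposed-is-root {a} exposed with partition a
  ... | inj₁ q = let (y , _ , e) = Q-perfect a q in ⊥-elim (exposed (y , e))
  ... | inj₂ (inj₂ sa) = let (i , e) = S-to-roots a sa in ⊥-elim (exposed (r i , e))
  ... | inj₂ (inj₁ ra) with Equivalence.to (R-union a) ra
  ... | j , h with a ≟ r j
  ... | yes a≡r = j , a≡r
  ... | no a≢r = let (u , _ , e) = H-near-perfect j a h a≢r in ⊥-elim (exposed (u , e))

  root-not-odd : ∀ j → ¬ Odd (r j)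
  root-not-odd j (inj₁ s)            = H∌S (r∈H j) s
  root-not-odd j (inj₂ (i , h , r≢)) = r≢ (same-component (r∈H j) h)

  Q-not-odd : Q v → ¬ Odd v
  Q-not-odd {v} q (inj₁ s)           = Q∩S v q s
  Q-not-odd     q (inj₂ (_ , h , _)) = H∌Q h q

  not-odd⇒not-OR : ¬ Odd v → ¬ OR K F v
  not-odd⇒not-OR {v} ¬odd o = ¬odd (Equivalence.to (OR-shape v) o)

  root-partner-in-S : F (r j) s ≡ true → S s
  root-partner-in-S {j} {s} e with S? s
  ... | inj₁ ss = ss
  ... | inj₂ ¬s = ⊥-elim (r-exposed-in-H j (s , H-closed (r∈H j) ¬s (F⊆G _ _ e) , e))

  ComponentRespecting : BRel n → Set
  ComponentRespecting E = ∀ {u w j} → H j u → E u w ≡ true → H j w ⊎ S w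

  K-respecting : ComponentRespecting K
  K-respecting {w = w} hu e with S? w
  ... | inj₁ sw = inj₂ sw
  ... | inj₂ ¬s = inj₁ (H-closed hu ¬s (∧-conicalˡ _ _ e))

  -- Where an alternating path from an exposed vertex may stand after an
  -- even (true) or odd (false) number of edges.
  Position : Bool → Fin n → Set
  Position true  u = ∃ λ j → H j u
  Position false u = Odd u

  InsidePath : BRel n → Fin m → Bool → Fin n → List (Fin n) → Set
  InsidePath E j c u vs = ∃ λ ws → Path E true (r j) c u ws × All (H j) ws × ws ⊆ vs

  record Invariant (E : BRel n) (c : Bool) (u : Fin n) (vs : List (Fin n)) : Set where
    field
      position    : Position c u
      avoids-Q    : ∀ {z} → z ∈ vs → ¬ Q z
      roots-first : ∀ {z j} → z ∈ vs → H j z → r j ∈ vs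
      inside      : ∀ {j} → H j u → InsidePath E j c u vs
  open Invariant

  root-visited : Invariant E c u vs → H j u → r j ∈ vs
  root-visited I hu = let (_ , p , _ , sub) = inside I hu in sub (start∈ p)

  invariant-start : ¬ Covered F a → Invariant E true a [ a ]
  invariant-start {E = E} exposed with exposed-is-root exposed
  ... | j , refl = record
    { position    = j , r∈H j
    ; avoids-Q    = λ { (here refl) → H∌Q (r∈H j) }
    ; roots-first = λ { (here refl) h → here (same-component h (r∈H j)) }
    ; inside      = inside′ }
    where
      inside′ : ∀ {k} → H k (r j) → InsidePath E k true (r j) [ r j ]
      inside′ {k} h with H-disjoint k j (r j) h (r∈H j)
      ... | refl = _ , start , h ∷ [] , id

  invariant-to-S : Invariant E true u vs → S w → Invariant E false w (w ∷ vs)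
  invariant-to-S I sw = record
    { position    = inj₁ sw
    ; avoids-Q    = λ { (here refl) q → Q∩S _ q sw ; (there z∈) → avoids-Q I z∈ }
    ; roots-first = λ { (here refl) h → ⊥-elim (H∌S h sw)
                      ; (there z∈) h → there (roots-first I z∈ h) }
    ; inside      = λ h → ⊥-elim (H∌S h sw) }

  invariant-to-root : Invariant E false u vs → Invariant E true (r k) (r k ∷ vs)
  invariant-to-root {E = E} {k = k} I = record
    { position    = k , r∈H k
    ; avoids-Q    = λ { (here refl) → H∌Q (r∈H k) ; (there z∈) → avoids-Q I z∈ }
    ; roots-first = λ { (here refl) h → here (same-component h (r∈H k))
                      ; (there z∈) h → there (roots-first I z∈ h) }
    ; inside      = inside′ }
    where
      inside′ : ∀ {j} → H j (r k) → InsidePath E j true (r k) (r k ∷ _)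
      inside′ {j} h with H-disjoint j k (r k) h (r∈H k)
      ... | refl = _ , start , h ∷ [] , λ { (here eq) → here eq }

  invariant-stay : Invariant E c u vs → H j u → H j w → Step E c u w → w ∉ vs →
                   Position (not c) w → Invariant E (not c) w (w ∷ vs)
  invariant-stay {E = E} {j = j} {w = w} I hu hw e w∉ pos = record
    { position    = pos
    ; avoids-Q    = λ { (here refl) → H∌Q hw ; (there z∈) → avoids-Q I z∈ }
    ; roots-first = λ { (here refl) h → there (subst (_∈ _) (same-component hw h) (root-visited I hu))
                      ; (there z∈) h → there (roots-first I z∈ h) }
    ; inside      = inside′ }
    where
      inside′ : ∀ {k} → H k w → InsidePath E k _ w (w ∷ _)
      inside′ {k} h with H-disjoint j k w hw h
      ... | refl with inside I hu
      ... | ws , p , inH , sub =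
        w ∷ ws , extend p e (w∉ ∘ sub) , hw ∷ inH ,
        λ { (here eq) → here eq ; (there z∈) → there (sub z∈) }

  -- K-steps out of Hⱼ stay
  -- in Hⱼ or enter S; F-steps lead from S to a root, or from Hⱼ \ rⱼ to the
  -- partner inside Hⱼ.
  invariant : ComponentRespecting E → ¬ Covered F a → Path E true a c u vs → Invariant E c u vs
  invariant resp exposed start = invariant-start exposed
  invariant resp exposed (extend {c = true} p e w∉) with invariant resp exposed p
  ... | I with position I
  ... | j , hu with resp hu e
  ... | inj₂ sw = invariant-to-S I sw
  ... | inj₁ hw = invariant-stay I hu hw e w∉ (inj₂ (j , hw , w≢r))
    where
      w≢r : _ ≢ r j
      w≢r w≡r = w∉ (subst (_∈ _) (sym w≡r) (root-visited I hu))
  invariant resp exposed (extend {c = false} {u = u} p e w∉) with invariant resp exposed p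
  ... | I with position I
  ... | inj₁ su with S-to-roots u su
  ... | k , ek with F-unique u _ (r k) e ek
  ... | refl = invariant-to-root I
  invariant resp exposed (extend {c = false} {u = u} p e w∉) | I | inj₂ (j , hu , u≢r)
    with H-near-perfect j u hu u≢r
  ... | u′ , hu′ , eu′ with F-unique u _ u′ e eu′
  ... | refl = invariant-stay I hu hu′ e w∉ (j , hu′)

  partner-before-root : ¬ Covered F a → Path K true a false s vs → F (r j) s ≡ true → r j ∉ vs
  partner-before-root {a} {s} {j = j} exposed P e rj∈ =
    arrive (Prefix.path pre) refl (Prefix.end∉ pre)
    where
      pre = prefix P rj∈ (F-loopless e)
      arrive : ∀ {c u ws} → Path K true a c u ws → u ≡ r j → s ∉ ws → ⊥
      arrive start a≡r _ = exposed (s , subst (λ t → F t s ≡ true) (sym a≡r) e)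
      arrive p@(extend {c = true} _ _ _) u≡r _ =
        root-not-odd j (subst Odd u≡r (position (invariant K-respecting exposed p)))
      arrive (extend {c = false} {u = t} q e′ _) refl s∉ =
        s∉ (there (subst (_∈ _) (F-unique (r j) t s (trans (F-sym (r j) t) e′) e) (end∈ q)))

  record EvenReach (x : Fin n) : Set where
    field
      origin   : Fin n
      exposed  : ¬ Covered F origin
      vertices : List (Fin n)
      path     : Path K true origin true x vertices

  record Root (j : Fin m) : Set where
    field
      reach : EvenReach (r j)
      meets-only-root : ∀ {z} → z ∈ EvenReach.vertices reach → H j z → z ≡ r j
    open EvenReach reach public

  -- Every component has a root path: either rⱼ is exposed, or its partner
  -- s ∈ S is oddly reachable and the path to s extends by the F-edge s rⱼ.
  root : ∀ j → Root j
  root j with any? (λ y → F (r j) y ≟ᵇ true)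
  ... | no exposed = record
    { reach = record { origin = r j ; exposed = exposed ; vertices = _ ; path = start }
    ; meets-only-root = λ { (here eq) _ → eq } }
  ... | yes (s , e) with Equivalence.from (OR-shape s) (inj₁ (root-partner-in-S e))
  ... | a , exposed , reach with fromOR reach
  ... | vs , P = record
    { reach = record { origin = a ; exposed = exposed ; vertices = _
                     ; path = extend P (trans (F-sym s (r j)) e) rj∉ }
    ; meets-only-root = meets }
    where
      rj∉ : r j ∉ vs
      rj∉ = partner-before-root exposed P e
      meets : ∀ {z} → z ∈ r j ∷ vs → H j z → z ≡ r j
      meets (here eq)  _  = eq
      meets (there z∈) hz = ⊥-elim (rj∉ (roots-first (invariant K-respecting exposed P) z∈ hz))

  root-avoids : (P : Root i) → r k ∉ Root.vertices P → ∀ {z} → z ∈ Root.vertices P → ¬ H k z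
  root-avoids P rk∉ z∈ hz =
    rk∉ (roots-first (invariant K-respecting (Root.exposed P) (Root.path P)) z∈ hz)

  reroot : (P : Root i) → r k ∈ Root.vertices P → i ≢ k →
           Σ (Root k) λ P′ → ∀ {z} → z ∈ Root.vertices P′ → ¬ H i z
  reroot {i} {k} P rk∈ i≢k = cut (prefix (Root.path P) rk∈ rk≢ri)
    where
      open Root P using (exposed)
      rk≢ri : r k ≢ r i
      rk≢ri eq = i≢k (H-disjoint i k (r k) (subst (H i) (sym eq) (r∈H i)) (r∈H k))
      cut : Prefix K true (Root.origin P) true (r i) (Root.vertices P) (r k) →
            Σ (Root k) λ P′ → ∀ {z} → z ∈ Root.vertices P′ → ¬ H i z
      cut record { colour = false ; path = p } =
        ⊥-elim (root-not-odd k (position (invariant K-respecting exposed p)))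
      cut record { colour = true ; vertices = ws ; path = p ; ⊆-whole = sub ; end∉ = ri∉ } =
        record { reach = record { origin = _ ; exposed = exposed ; vertices = ws ; path = p }
               ; meets-only-root = meets } ,
        λ z∈ hz → ri∉ (subst (_∈ ws) (Root.meets-only-root P (sub z∈) hz) z∈)
        where
          meets : ∀ {z} → z ∈ ws → H k z → z ≡ r k
          meets {z} z∈ hz with z ≟ r k
          ... | yes z≡rk = z≡rk
          ... | no z≢rk =
            let pre = prefix p z∈ z≢rk
                I = invariant K-respecting exposed (Prefix.path pre)
            in ⊥-elim (Prefix.end∉ pre (roots-first I (end∈ (Prefix.path pre)) hz))

  partner-reached-evenly : F x x′ ≡ true → Path E true a false x′ vs → x ∈ vs →
                           ∃ λ ws → Path E true a true x ws
  partner-reached-evenly {x} {x′} {E} {a} {vs = vs} e P x∈ = evenly (prefix P x∈ (F-loopless e))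
    where
      evenly : Prefix E true a false x′ vs x → ∃ λ ws → Path E true a true x ws
      evenly record { colour = true ; path = p } = _ , p
      evenly record { colour = false ; exit = exit ; next-end = next-end }
        with next-end (F-unique x _ x′ exit e)
      ... | ()

  even-reach : H i x → EvenReach x
  even-reach {i} {x} hx with x ≟ r i
  ... | yes refl = Root.reach (root i)
  ... | no x≢r with H-near-perfect i x hx x≢r
  ... | x′ , hx′ , e with Equivalence.from (OR-shape x′) (inj₂ (i , hx′ , x′≢r))
    where
      x′≢r : x′ ≢ r i
      x′≢r refl = r-exposed-in-H i (x , hx , trans (F-sym (r i) x) e)
  ... | a , exposed , reach with fromOR reach
  ... | vs , P with x ∈? vs
  ... | no x∉ = record { origin = a ; exposed = exposed ; vertices = _
                       ; path = extend P (trans (F-sym x′ x) e) x∉ }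
  ... | yes x∈ = let (_ , p) = partner-reached-evenly e P x∈ in
                 record { origin = a ; exposed = exposed ; vertices = _ ; path = p }

  inside-path : H j u → ∃ λ ws → Path K true (r j) true u ws × All (H j) ws
  inside-path hu with even-reach hu
  ... | record { exposed = exposed ; path = P } with inside (invariant K-respecting exposed P) hu
  ... | ws , p , inH , _ = ws , p , inH

  Listed : Fin n → Fin n → Set
  Listed x y = (∃ λ i → ∃ λ k → i ≢ k × H i x × H k y) ⊎
               (∃ λ i → H i x × Q y) ⊎ (∃ λ i → H i y × Q x)

  module Pair (x y : Fin n) where

    E′ : BRel n
    E′ = addPair K x y

    K⊑E′ : K ⊑ E′
    K⊑E′ = addPair-⊒

    E′-xy : E′ x y ≡ true
    E′-xy = addPair-ab {E = K}

    E′-yx : E′ y x ≡ true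
    E′-yx = addPair-ba {E = K}

    NewVertex : Set
    NewVertex = ∃ λ v → OR E′ F v × ¬ OR K F v

    -- Through the edge pq between components Hⱼ and Hₗ, a root path of Hⱼ
    -- avoiding Hₗ extends to an odd E′-path to rₗ.
    join : ∀ {j l p q} → j ≢ l → H j p → H l q → E′ p q ≡ true →
           (P : Root j) → (∀ {z} → z ∈ Root.vertices P → ¬ H l z) → OR E′ F (r l)
    join {j} {l} {p} {q} j≢l hp hq epq P avoid
      with inside-path hp | inside-path hq
    ... | ws₁ , S₁ , inHj | ws₂ , S₂ , inHl
      with append (path-mono K⊑E′ (Root.path P)) (path-mono K⊑E′ S₁) meet₁
      where
        meet₁ : ∀ {z} → z ∈ ws₁ → z ∈ Root.vertices P → z ≡ r j
        meet₁ z∈ws₁ z∈P = Root.meets-only-root P z∈P (All.lookup inHj z∈ws₁)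
    ... | zs , to-p , cover with reverse K-sym F-sym S₂
    ... | ws₃ , from-q , sub₃
      with append (extend to-p epq q∉) (path-mono K⊑E′ from-q) meet₂
      where
        disjoint : ∀ {z} → z ∈ zs → ¬ H l z
        disjoint z∈ hz with cover z∈
        ... | inj₁ z∈P   = avoid z∈P hz
        ... | inj₂ z∈ws₁ = j≢l (H-disjoint j l _ (All.lookup inHj z∈ws₁) hz)
        q∉ : q ∉ zs
        q∉ q∈ = disjoint q∈ hq
        meet₂ : ∀ {z} → z ∈ ws₃ → z ∈ q ∷ zs → z ≡ q
        meet₂ _     (here eq)  = eq
        meet₂ z∈ws₃ (there z∈) = ⊥-elim (disjoint z∈ (All.lookup inHl (sub₃ z∈ws₃)))
    ... | _ , to-rl , _ = Root.origin P , Root.exposed P , toOR to-rl refl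

    -- x ∈ Hᵢ, y ∈ Hₖ: join through xy from the root path of Hᵢ, or, if that
    -- path passes rₖ, through yx from the rerooted path of Hₖ.
    enrich-HH : i ≢ k → H i x → H k y → NewVertex
    enrich-HH {i} {k} i≢k hx hy with r k ∈? Root.vertices (root i)
    ... | no rk∉ =
      r k , join i≢k hx hy E′-xy (root i) (root-avoids (root i) rk∉) ,
      not-odd⇒not-OR (root-not-odd k)
    ... | yes rk∈ = let (P , avoid) = reroot (root i) rk∈ i≢k in
      r i , join (i≢k ∘ sym) hy hx E′-yx P avoid , not-odd⇒not-OR (root-not-odd i)

    -- p ∈ Hᵢ, q ∈ Q: an even path to p (which avoids Q) followed by pq.
    enrich-Q : ∀ {p q} → H i p → Q q → E′ p q ≡ true → NewVertex
    enrich-Q {q = q} hp qq epq with even-reach hp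
    ... | record { origin = a ; exposed = exposed ; path = P } =
      q , (a , exposed , toOR (extend (path-mono K⊑E′ P) epq q∉) refl) ,
      not-odd⇒not-OR (Q-not-odd qq)
      where
        q∉ : q ∉ _
        q∉ q∈ = avoids-Q (invariant K-respecting exposed P) q∈ qq

    Half : Fin n → Fin n → Set
    Half u v = ∀ {j} → H j u → H j v ⊎ S v

    half-to-S : S v → Half u v
    half-to-S sv _ = inj₂ sv

    half-from-outside : (∀ {j} → ¬ H j u) → Half u v
    half-from-outside ¬h h = ⊥-elim (¬h h)

    half-same : H i u → H i v → Half u v
    half-same {i} {u} hu hv h = inj₁ (subst (λ t → H t _) (H-disjoint i _ u hu h) hv)

    Harmless : Set
    Harmless = Half x y × Half y x

    listed-or-harmless : Listed x y ⊎ Harmless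
    listed-or-harmless with side x | side y
      where
        side : ∀ v → Q v ⊎ (∃ λ j → H j v) ⊎ S v
        side v with partition v
        ... | inj₁ q         = inj₁ q
        ... | inj₂ (inj₁ rv) = inj₂ (inj₁ (Equivalence.to (R-union v) rv))
        ... | inj₂ (inj₂ sv) = inj₂ (inj₂ sv)
    ... | inj₂ (inj₂ sx) | _ = inj₂ (half-from-outside (λ h → H∌S h sx) , half-to-S sx)
    ... | _ | inj₂ (inj₂ sy) = inj₂ (half-to-S sy , half-from-outside (λ h → H∌S h sy))
    ... | inj₁ qx | inj₁ qy =
      inj₂ (half-from-outside (λ h → H∌Q h qx) , half-from-outside (λ h → H∌Q h qy))
    ... | inj₁ qx | inj₂ (inj₁ (k , hy)) = inj₁ (inj₂ (inj₂ (k , hy , qx)))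
    ... | inj₂ (inj₁ (i , hx)) | inj₁ qy = inj₁ (inj₂ (inj₁ (i , hx , qy)))
    ... | inj₂ (inj₁ (i , hx)) | inj₂ (inj₁ (k , hy)) with i ≟ k
    ... | no i≢k  = inj₁ (inj₁ (i , k , i≢k , hx , hy))
    ... | yes refl = inj₂ (half-same hx hy , half-same hy hx)

    E′-respecting : Harmless → ComponentRespecting E′
    E′-respecting (xy , yx) hu e with addPair-cases {E = K} {a = x} {b = y} e
    ... | inj₁ ek                   = K-respecting hu ek
    ... | inj₂ (inj₁ (refl , refl)) = xy hu
    ... | inj₂ (inj₂ (refl , refl)) = yx hu

    harmless-not-enriching : Harmless → OR E′ F v → OR K F v
    harmless-not-enriching {v} harmless (a , exposed , reach) with fromOR reach
    ... | _ , P = Equivalence.from (OR-shape v) (position (invariant (E′-respecting harmless) exposed P))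

    characterisation : Enriching K F x y ⇔ Listed x y
    characterisation = mk⇔ necessary sufficient
      where
        necessary : Enriching K F x y → Listed x y
        necessary (_ , v , new , old) with listed-or-harmless
        ... | inj₁ listed   = listed
        ... | inj₂ harmless = ⊥-elim (old (harmless-not-enriching harmless new))
        sufficient : Listed x y → Enriching K F x y
        sufficient (inj₁ (i , k , i≢k , hx , hy)) = (λ _ → OR-mono K⊑E′) , enrich-HH i≢k hx hy
        sufficient (inj₂ (inj₁ (i , hx , qy)))    = (λ _ → OR-mono K⊑E′) , enrich-Q hx qy E′-xy
        sufficient (inj₂ (inj₂ (i , hy , qx)))    = (λ _ → OR-mono K⊑E′) , enrich-Q hy qx E′-yx

lemma3p9 : ∀ {n m : ℕ} (G : Graph n) (F : BRel n)
    (Q R S : VSet n) (H : Fin m → VSet n) (r : Fin m → Fin n) →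
    IsMaximumMatching G F →
    (∀ v → Q v ⊎ R v ⊎ S v) →
    (∀ v → Q v → ¬ R v) → (∀ v → Q v → ¬ S v) → (∀ v → R v → ¬ S v) →
    (∀ q → Q q → ∃ λ y → Q y × F q y ≡ true) →
    (∀ v → R v ⇔ (∃ λ i → H i v)) →
    (∀ i k v → H i v → H k v → i ≡ k) →
    (∀ i → IsComponentMinus G S (H i)) →
    (∀ i → Hypomatchable G (H i)) →
    (∀ i → H i (r i)) →
    (∀ i v → H i v → v ≢ r i → ∃ λ u → H i u × F v u ≡ true) →
    (∀ i → ¬ (∃ λ u → H i u × F (r i) u ≡ true)) →
    (∀ s → S s → ∃ λ i → F s (r i) ≡ true) →
    (∀ v → OR (Kof G F) F v ⇔ (S v ⊎ (∃ λ i → H i v × v ≢ r i))) →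
    ∀ x y → x ≢ y → adj G x y ≡ false →
    (Enriching (Kof G F) F x y ⇔
      ((∃ λ i → ∃ λ k → i ≢ k × H i x × H k y) ⊎
       (∃ λ i → H i x × Q y) ⊎
       (∃ λ i → H i y × Q x)))
lemma3p9 G F Q R S H r maximum partition Q∩R Q∩S R∩S Q-perfect R-union H-disjoint
         H-component _ r∈H H-near-perfect r-exposed-in-H S-to-roots OR-shape x y _ _ =
  Decomposition.Pair.characterisation G F Q R S H r (IsMaximumMatching.matching maximum)
    partition Q∩R Q∩S R∩S Q-perfect R-union H-disjoint H-component r∈H H-near-perfect
    r-exposed-in-H S-to-roots OR-shape x y
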